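{- Let $m\in\mathbb N$, $n\in\mathbb N^m\setminus\{1_m\}$, and let $M\in\mathbb N_0^n$ be a principal reversible cuboid. Let $\tilde n\in\mathbb N^m$, $\tilde n\le n$, be such that $M_{[\tilde n]}$ is a principal reversible subcuboid. Let $j\in\{1,\dots,m\}$ and $\hat n\in\mathbb N^m$ with $\hat n_i=\tilde n_i$ for $i\ne j$ and $\hat n_j<\tilde n_j$. Then $\mu_{\hat n}=a_{j,\hat n_j}$.
   Context: $\mathbb N=\{1,2,\dots\}$, $\mathbb N_0=\mathbb N\cup\{0\}$, $\langle N\rangle=\{0,\dots,N-1\}$. For $n\in\mathbb N^m$, a cuboid $M\in\mathbb N_0^n$ has entries $M_k\in\mathbb N_0$ for $k\in\mathbb N^m$, $k\le n$ componentwise; $1_m=(1,\dots,1)$, $e_j$ the $j$-th unit vector. Property (V): for all $1\le i<j\le m$ and all index vectors in range, $M_{k_1,\dots,k_i,\dots,k_j,\dots,k_m}+M_{k_1,\dots,k_i',\dots,k_j',\dots,k_m}=M_{k_1,\dots,k_i,\dots,k_j',\dots,k_m}+M_{k_1,\dots,k_i',\dots,k_j,\dots,k_m}$ (vacuous if $m=1$). $M$ is a principal reversible cuboid if it has (V), its set of entries is $\langle\prod_jn_j\rangle$, and $M_k<M_{k+le_j}$ whenever $1\le l\le n_j-k_j$ (dimensions equal to 1 allowed). For $\tilde n\le n$, $M_{[\tilde n]}=(M_k)_{k\le\tilde n}$; it is a principal reversible subcuboid if it is itself a principal reversible cuboid. $\mu_{\tilde n}=\min\{N\in\mathbb N: N\ne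 M_k\text{ for all }k\le\tilde n\}$. For $k\in\langle n_j\rangle$, $a_{j,k}:=M_{1_m+ke_j}$. -}

module Defs where

open import Data.Nat using (ℕ; zero; suc; _+_; _*_; _≤_; _<_)
open import Data.Fin using (Fin) renaming (_<_ to _<ᶠ_)
open import Data.Vec using (Vec; lookup; replicate; foldr; _[_]≔_)
open import Data.Product using (Σ; _×_; ∃-syntax)
open import Relation.Binary.PropositionalEquality using (_≡_)
open import Relation.Nullary using (¬_)

-- Conventions: m-tuples of naturals are 'Vec ℕ m'; indices are 1-based
-- as in the paper.  A cuboid M ∈ ℕ₀^n is represented by a function
-- M : Vec ℕ m → ℕ of which only the values at in-range indices
-- (1 ≤ k_i ≤ n_i for all i) are relevant; every notion below only
-- inspects in-range entries.

prod : ∀ {m} → Vec ℕ m → ℕ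
prod = foldr _ _*_ 1

Positive : ∀ {m} → Vec ℕ m → Set
Positive {m} n = (i : Fin m) → 1 ≤ lookup n i

_≤ᵥ_ : ∀ {m} → Vec ℕ m → Vec ℕ m → Set
_≤ᵥ_ {m} a b = (i : Fin m) → lookup a i ≤ lookup b i

InRange : ∀ {m} → Vec ℕ m → Vec ℕ m → Set
InRange {m} n k = (i : Fin m) → (1 ≤ lookup k i) × (lookup k i ≤ lookup n i)

one : (m : ℕ) → Vec ℕ m
one m = replicate m 1

PropertyV : ∀ {m} → Vec ℕ m → (Vec ℕ m → ℕ) → Set
PropertyV {m} n M =
  (i j : Fin m) → i <ᶠ j →
  (k : Vec ℕ m) → InRange n k →
  (a b : ℕ) → 1 ≤ a → a ≤ lookup n i → 1 ≤ b → b ≤ lookup n j →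
  M k + M ((k [ i ]≔ a) [ j ]≔ b) ≡ M (k [ j ]≔ b) + M (k [ i ]≔ a)

EntriesAreRange : ∀ {m} → Vec ℕ m → (Vec ℕ m → ℕ) → Set
EntriesAreRange n M =
  ((k : Vec ℕ _) → InRange n k → M k < prod n) ×
  ((N : ℕ) → N < prod n → ∃[ k ] (InRange n k × M k ≡ N))

StrictlyIncreasing : ∀ {m} → Vec ℕ m → (Vec ℕ m → ℕ) → Set
StrictlyIncreasing {m} n M =
  (k : Vec ℕ m) → InRange n k → (j : Fin m) → (l : ℕ) →
  1 ≤ l → lookup k j + l ≤ lookup n j →
  M k < M (k [ j ]≔ (lookup k j + l))

-- principal reversible cuboid of size n (for ñ ≤ n, "M_[ñ] is a
-- principal reversible subcuboid" is  PrincipalReversible ñ M)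
PrincipalReversible : ∀ {m} → Vec ℕ m → (Vec ℕ m → ℕ) → Set
PrincipalReversible n M =
  PropertyV n M × EntriesAreRange n M × StrictlyIncreasing n M

-- N = μ_ñ = min { N ∈ ℕ : N ≠ M_k for all k ≤ ñ }
IsMu : ∀ {m} → Vec ℕ m → (Vec ℕ m → ℕ) → ℕ → Set
IsMu {m} ñ M N =
  1 ≤ N ×
  ((k : Vec ℕ m) → InRange ñ k → ¬ (M k ≡ N)) ×
  ((N' : ℕ) → 1 ≤ N' → N' < N → ∃[ k ] (InRange ñ k × M k ≡ N'))

a : ∀ {m} → (Vec ℕ m → ℕ) → Fin m → ℕ → ℕ
a {m} M j k = M (one m [ j ]≔ (1 + k))

module Submission where

-- Let M be a principal reversible cuboid of size ñ, fix a direction j and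
-- a height t = n̂ⱼ with 1 ≤ t < ñⱼ, so that the box n̂ is the slab of ñ
-- cut by kⱼ ≤ t.  The claim μ_n̂ = a_{j,t} = M(c), where c = 1_m + t·e_j is
-- the "corner" just above the slab, rests on two structural facts about M
-- on its box:
--   * M is injective: the box has ∏ ñ points and M maps them onto ⟨∏ ñ⟩,
--     so a finite pigeonhole argument (via an enumeration of the box by
--     Fin (∏ ñ)) rules out collisions;
--   * M is monotone for the componentwise order, by chaining the
--     single-coordinate increases of the definition.
-- Then: M(c) > M(1_m) ≥ 0; M(c) is not a value on the slab, since c lies
-- outside it and M is injective; and every N < M(c) is a value M(k) with
-- k in the box, and kⱼ ≤ t is forced, for otherwise c ≤ k and monotonicity
-- gives M(c) ≤ M(k) = N.

open import Defs
open import Data.Nat using (ℕ; zero; suc; _+_; _∸_; _≤_; _<_; s≤s; z≤n; _≤?_)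
open import Data.Nat.Properties
  using (≤-refl; ≤-trans; <⇒≤; <-trans; ≤-<-trans; <-≤-trans; ≰⇒>; n≮n;
         +-identityʳ; m+[n∸m]≡n)
open import Data.Fin as Fin using (Fin; toℕ; fromℕ<; remQuot; combine; punchIn; punchOut)
open import Data.Fin.Properties
  using (toℕ-injective; toℕ<n; toℕ-fromℕ<; remQuot-combine; punchIn-punchOut; injective⇒≤)
open import Data.Vec using (Vec; []; _∷_; lookup; _[_]≔_)
open import Data.Vec.Properties using (lookup∘update; lookup∘update′; []≔-lookup; lookup-replicate)
open import Data.Product using (_×_; _,_; proj₁; proj₂; ∃-syntax)
open import Data.Empty using (⊥-elim)
open import Function using (_∘_)
open import Function.Definitions using (Injective)
open import Relation.Nullary using (¬_; yes; no)
open import Relation.Binary.PropositionalEquality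
  using (_≡_; _≢_; refl; sym; trans; cong; cong₂; subst)

-- Removing one point of a collision leaves a map on Fin N'
-- still attaining all N' + 1 values, whose section Fin (N' + 1) → Fin N'
-- would be injective.
ontoBelow⇒injective : ∀ {N} (f : Fin N → ℕ) → (∀ x → x < N → ∃[ i ] f i ≡ x) →
                      Injective _≡_ _≡_ f
ontoBelow⇒injective {zero} f onto {()}
ontoBelow⇒injective {suc N'} f onto {i} {i'} fi≡fi' with i Fin.≟ i'
... | yes i≡i' = i≡i'
... | no i≢i'  = ⊥-elim (n≮n N' (injective⇒≤ section-injective))
  where
  f-without-i' : Fin N' → ℕ
  f-without-i' y = f (punchIn i' y)

  still-onto : ∀ x → x < suc N' → ∃[ y ] f-without-i' y ≡ x
  still-onto x x<N with onto x x<N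
  ... | z , fz≡x with z Fin.≟ i'
  ... | yes refl = punchOut (i≢i' ∘ sym) ,
                   trans (cong f (punchIn-punchOut (i≢i' ∘ sym))) (trans fi≡fi' fz≡x)
  ... | no z≢i'  = punchOut (z≢i' ∘ sym) ,
                   trans (cong f (punchIn-punchOut (z≢i' ∘ sym))) fz≡x

  section : Fin (suc N') → Fin N'
  section y = proj₁ (still-onto (toℕ y) (toℕ<n y))

  section-injective : Injective _≡_ _≡_ section
  section-injective {y} {y'} eq = toℕ-injective same-value
    where
    same-value : toℕ y ≡ toℕ y'
    same-value = trans (sym (proj₂ (still-onto (toℕ y) (toℕ<n y))))
                        (trans (cong f-without-i' eq) (proj₂ (still-onto (toℕ y') (toℕ<n y'))))

-- Enumeration of the box {k : 1_m ≤ k ≤ n} by Fin (∏ n), in mixed radix.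
boxPoint : ∀ {m} (n : Vec ℕ m) → Fin (prod n) → Vec ℕ m
boxPoint [] _ = []
boxPoint (x ∷ xs) p = suc (toℕ (proj₁ q)) ∷ boxPoint xs (proj₂ q)
  where q = remQuot {x} (prod xs) p

boxPoint-surjective : ∀ {m} (n : Vec ℕ m) (k : Vec ℕ m) → InRange n k →
                      ∃[ p ] boxPoint n p ≡ k
boxPoint-surjective [] [] _ = Fin.zero , refl
boxPoint-surjective (x ∷ xs) (zero ∷ ks) k∈n with proj₁ (k∈n Fin.zero)
... | ()
boxPoint-surjective (x ∷ xs) (suc c ∷ ks) k∈n
  with boxPoint-surjective xs ks (k∈n ∘ Fin.suc)
... | p , p↦ks = combine head p , head-and-tail
  where
  head : Fin x
  head = fromℕ< (proj₂ (k∈n Fin.zero))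

  head-and-tail : boxPoint (x ∷ xs) (combine head p) ≡ suc c ∷ ks
  head-and-tail =
    trans (cong (λ q → suc (toℕ (proj₁ q)) ∷ boxPoint xs (proj₂ q)) (remQuot-combine head p))
          (cong₂ _∷_ (cong suc (toℕ-fromℕ< (proj₂ (k∈n Fin.zero)))) p↦ks)

entries-injective : ∀ {m} (n : Vec ℕ m) (M : Vec ℕ m → ℕ) → EntriesAreRange n M →
                    ∀ {k k'} → InRange n k → InRange n k' → M k ≡ M k' → k ≡ k'
entries-injective n M (_ , attained) {k} {k'} k∈n k'∈n Mk≡Mk'
  with boxPoint-surjective n k k∈n | boxPoint-surjective n k' k'∈n
... | p , refl | p' , refl = cong (boxPoint n) (ontoBelow⇒injective (M ∘ boxPoint n) onto Mk≡Mk')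
  where
  onto : ∀ x → x < prod n → ∃[ p ] M (boxPoint n p) ≡ x
  onto x x<∏n with attained x x<∏n
  ... | k , k∈n , Mk≡x with boxPoint-surjective n k k∈n
  ... | p , refl = p , Mk≡x

CoordinateMonotone : ∀ {m} → Vec ℕ m → (Vec ℕ m → ℕ) → Set
CoordinateMonotone {m} n M =
  ∀ k → InRange n k → (i : Fin m) (v : ℕ) → lookup k i ≤ v → v ≤ lookup n i →
  M k ≤ M (k [ i ]≔ v)

increasing⇒coordinateMonotone : ∀ {m} (n : Vec ℕ m) (M : Vec ℕ m → ℕ) →
                                StrictlyIncreasing n M → CoordinateMonotone n M
increasing⇒coordinateMonotone n M increasing k k∈n i v kᵢ≤v v≤nᵢ =
  subst (λ w → M k ≤ M (k [ i ]≔ w)) (m+[n∸m]≡n kᵢ≤v)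
        (raiseBy (v ∸ lookup k i) (subst (_≤ lookup n i) (sym (m+[n∸m]≡n kᵢ≤v)) v≤nᵢ))
  where
  raiseBy : ∀ l → lookup k i + l ≤ lookup n i → M k ≤ M (k [ i ]≔ (lookup k i + l))
  raiseBy zero _ rewrite +-identityʳ (lookup k i) | []≔-lookup k i = ≤-refl
  raiseBy (suc l) in-box = <⇒≤ (increasing k k∈n i (suc l) (s≤s z≤n) in-box)

coordinateMonotone⇒monotone : ∀ {m} (n : Vec ℕ m) (M : Vec ℕ m → ℕ) → CoordinateMonotone n M →
                              ∀ {k k'} → InRange n k → InRange n k' → k ≤ᵥ k' → M k ≤ M k'
coordinateMonotone⇒monotone [] M _ {[]} {[]} _ _ _ = ≤-refl
coordinateMonotone⇒monotone (x ∷ xs) M mono {c ∷ ks} {c' ∷ ks'} k∈n k'∈n k≤k' =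
  ≤-trans (mono (c ∷ ks) k∈n Fin.zero c' (k≤k' Fin.zero) (proj₂ (k'∈n Fin.zero)))
          (coordinateMonotone⇒monotone xs (M ∘ (c' ∷_)) tail-mono
             (k∈n ∘ Fin.suc) (k'∈n ∘ Fin.suc) (k≤k' ∘ Fin.suc))
  where
  tail-mono : CoordinateMonotone xs (M ∘ (c' ∷_))
  tail-mono v v∈xs i = mono (c' ∷ v) (λ { Fin.zero → k'∈n Fin.zero ; (Fin.suc i') → v∈xs i' })
                            (Fin.suc i)

corner : (m : ℕ) → Fin m → ℕ → Vec ℕ m
corner m j t = one m [ j ]≔ suc t

lookup-one : ∀ {m} (i : Fin m) → lookup (one m) i ≡ 1
lookup-one i = lookup-replicate i 1

lookup-corner-at : ∀ {m} j t → lookup (corner m j t) j ≡ suc t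
lookup-corner-at {m} j t = lookup∘update j (one m) (suc t)

lookup-corner-off : ∀ {m} {i j : Fin m} t → i ≢ j → lookup (corner m j t) i ≡ 1
lookup-corner-off {m} {i} t i≢j = trans (lookup∘update′ i≢j (one m) (suc t)) (lookup-one i)

one-inRange : ∀ {m} (n : Vec ℕ m) → Positive n → InRange n (one m)
one-inRange n pos i rewrite lookup-one i = ≤-refl , pos i

corner-inRange : ∀ {m} (n : Vec ℕ m) → Positive n → ∀ j t → t < lookup n j →
                 InRange n (corner m j t)
corner-inRange n pos j t t<nⱼ i with i Fin.≟ j
... | yes refl rewrite lookup-corner-at i t = s≤s z≤n , t<nⱼ
... | no i≢j   rewrite lookup-corner-off t i≢j = ≤-refl , pos i

one<corner : ∀ {m} (n : Vec ℕ m) (M : Vec ℕ m → ℕ) → Positive n → StrictlyIncreasing n M →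
             ∀ j t → 1 ≤ t → t < lookup n j → M (one m) < M (corner m j t)
one<corner {m} n M pos increasing j t 1≤t t<nⱼ =
  subst (λ w → M (one m) < M (one m [ j ]≔ w)) (cong (_+ t) (lookup-one j))
        (increasing (one m) (one-inRange n pos) j t 1≤t
                    (subst (λ w → w + t ≤ lookup n j) (sym (lookup-one j)) t<nⱼ))

IsSlab : ∀ {m} → Vec ℕ m → Fin m → Vec ℕ m → Set
IsSlab {m} ñ j n̂ = ((i : Fin m) → i ≢ j → lookup n̂ i ≡ lookup ñ i) × lookup n̂ j < lookup ñ j

slab⊆box : ∀ {m} (ñ n̂ : Vec ℕ m) {j} → IsSlab ñ j n̂ → ∀ k → InRange n̂ k → InRange ñ k
slab⊆box ñ n̂ {j} (same , n̂ⱼ<ñⱼ) k k∈n̂ i with i Fin.≟ j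
... | yes refl = proj₁ (k∈n̂ i) , <⇒≤ (≤-<-trans (proj₂ (k∈n̂ i)) n̂ⱼ<ñⱼ)
... | no i≢j   = proj₁ (k∈n̂ i) , subst (_ ≤_) (same i i≢j) (proj₂ (k∈n̂ i))

box-below⊆slab : ∀ {m} (ñ n̂ : Vec ℕ m) {j} → IsSlab ñ j n̂ →
                 ∀ k → InRange ñ k → lookup k j ≤ lookup n̂ j → InRange n̂ k
box-below⊆slab ñ n̂ {j} (same , _) k k∈ñ kⱼ≤n̂ⱼ i with i Fin.≟ j
... | yes refl = proj₁ (k∈ñ i) , kⱼ≤n̂ⱼ
... | no i≢j   = proj₁ (k∈ñ i) , subst (_ ≤_) (sym (same i i≢j)) (proj₂ (k∈ñ i))

corner-not-in-slab : ∀ {m} (ñ n̂ : Vec ℕ m) {j} (M : Vec ℕ m → ℕ) →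
                     Positive ñ → EntriesAreRange ñ M → (slab : IsSlab ñ j n̂) →
                     ∀ k → InRange n̂ k → M k ≢ M (corner m j (lookup n̂ j))
corner-not-in-slab {m} ñ n̂ {j} M pos entries slab@(_ , n̂ⱼ<ñⱼ) k k∈n̂ Mk≡Mc =
  n≮n (lookup n̂ j) (subst (_≤ lookup n̂ j) kⱼ≡suc-t (proj₂ (k∈n̂ j)))
  where
  kⱼ≡suc-t : lookup k j ≡ suc (lookup n̂ j)
  kⱼ≡suc-t = trans (cong (λ v → lookup v j)
                         (entries-injective ñ M entries (slab⊆box ñ n̂ slab k k∈n̂)
                            (corner-inRange ñ pos j _ n̂ⱼ<ñⱼ) Mk≡Mc))
                   (lookup-corner-at j _)

corner≤above : ∀ {m} (n : Vec ℕ m) (M : Vec ℕ m → ℕ) → Positive n → StrictlyIncreasing n M →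
               ∀ j t k → InRange n k → t < lookup k j → M (corner m j t) ≤ M k
corner≤above {m} n M pos increasing j t k k∈n t<kⱼ =
  coordinateMonotone⇒monotone n M (increasing⇒coordinateMonotone n M increasing)
    (corner-inRange n pos j t (<-≤-trans t<kⱼ (proj₂ (k∈n j)))) k∈n corner≤k
  where
  corner≤k : corner m j t ≤ᵥ k
  corner≤k i with i Fin.≟ j
  ... | yes refl rewrite lookup-corner-at i t = t<kⱼ
  ... | no i≢j   rewrite lookup-corner-off t i≢j = proj₁ (k∈n i)

-- Every value below the corner entry is attained on the slab: it is
-- attained at some box point k, and kⱼ above the slab would put the
-- corner below k.
below-corner-in-slab : ∀ {m} (ñ n̂ : Vec ℕ m) {j} (M : Vec ℕ m → ℕ) →
                       Positive ñ → EntriesAreRange ñ M → StrictlyIncreasing ñ M →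
                       (slab : IsSlab ñ j n̂) →
                       ∀ N → N < M (corner m j (lookup n̂ j)) → ∃[ k ] (InRange n̂ k × M k ≡ N)
below-corner-in-slab {m} ñ n̂ {j} M pos entries increasing slab@(_ , n̂ⱼ<ñⱼ) N N<Mc =
  attained-in-slab (proj₂ entries N (<-trans N<Mc (proj₁ entries _ corner∈ñ)))
  where
  corner∈ñ : InRange ñ (corner m j (lookup n̂ j))
  corner∈ñ = corner-inRange ñ pos j _ n̂ⱼ<ñⱼ

  attained-in-slab : ∃[ k ] (InRange ñ k × M k ≡ N) → ∃[ k ] (InRange n̂ k × M k ≡ N)
  attained-in-slab (k , k∈ñ , Mk≡N) with lookup k j ≤? lookup n̂ j
  ... | yes kⱼ≤n̂ⱼ = k , box-below⊆slab ñ n̂ slab k k∈ñ kⱼ≤n̂ⱼ , Mk≡N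
  ... | no kⱼ≰n̂ⱼ  = ⊥-elim (n≮n N (<-≤-trans N<Mc
                      (subst (_ ≤_) Mk≡N (corner≤above ñ M pos increasing j _ k k∈ñ (≰⇒> kⱼ≰n̂ⱼ)))))

corollary2 : (m : ℕ) (n : Vec ℕ m) → Positive n → ¬ (n ≡ one m) →
    (M : Vec ℕ m → ℕ) → PrincipalReversible n M →
    (ñ : Vec ℕ m) → Positive ñ → ñ ≤ᵥ n → PrincipalReversible ñ M →
    (j : Fin m) (n̂ : Vec ℕ m) → Positive n̂ →
    ((i : Fin m) → ¬ (i ≡ j) → lookup n̂ i ≡ lookup ñ i) →
    lookup n̂ j < lookup ñ j →
    IsMu n̂ M (a M j (lookup n̂ j))
corollary2 _ _ _ _ M _ ñ ñ-pos _ (_ , entries , increasing) j n̂ n̂-pos same n̂ⱼ<ñⱼ =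
  corner-positive ,
  corner-not-in-slab ñ n̂ M ñ-pos entries slab ,
  (λ N _ → below-corner-in-slab ñ n̂ M ñ-pos entries increasing slab N)
  where
  slab : IsSlab ñ j n̂
  slab = same , n̂ⱼ<ñⱼ

  corner-positive : 1 ≤ a M j (lookup n̂ j)
  corner-positive = ≤-<-trans z≤n (one<corner ñ M ñ-pos increasing j _ (n̂-pos j) n̂ⱼ<ñⱼ)
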